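{- Let $k<\omega$, let $M$ be a $k$-model on an $m$-transitive Kripke frame $F$ over a finite alphabet $\mathrm{Al}$ ($m<\omega$), let $Y$ be an upset in $M$ with $\mathrm{md}(M\restriction Y)\le d<\omega$, let $Z={\sim}[Y]$, and put $D=m+d+1$. Then: (1) for each $a\in Z$ and each $b$ in $M$, if $a\sim_{M,D}b$, then $b\in Z$ and $a\sim b$; (2) $Z$ is an upset in $M$; (3) $Z$ is definable in $M$ by a $k$-formula of modal depth at most $D$ (i.e. $Z$ is the set of points of $M$ where that formula is true); (4) $\mathrm{md}(M\restriction Z)\le D$.
   Context: A $k$-model is $M=(F,\theta)$ with $F=(X,(R_\Diamond)_{\Diamond\in\mathrm{Al}})$ a Kripke frame and $\theta$ a map from $\{p_i:i<k\}$ to $\mathcal P(X)$; truth is standard ($M,a\models\Diamond\varphi$ iff $M,b\models\varphi$ for some $b$ with $aR_\Diamond b$). A $k$-formula uses only $p_0,\dots,p_{k-1}$; modal depth is maximal nesting of modalities. $F$ is $m$-transitive if $R_F^{m+1}\subseteq\bigcup_{i\le m}R_F^i$ where $R_F=\bigcup_\Diamond R_\Diamond$. $Y$ is an upset if $R_\Diamond[Y]\subseteq Y$ for all $\Diamond$; $M\restriction Y$ is the model on $F\restriction Y$ with valuation $p\mapsto\theta(p)\cap Y$. For $d<\omega$, $a\sim_{M,d}b$ iff $a,b$ satisfy the same $k$-formulas of modal depth $\le d$; $\sim$ (also $\sim_{M,\omega}$) means $a,b$ satisfy the same $k$-formulas. ${\sim}[Y]$ is the union of all $\sim$-classes meeting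 $Y$. The modal depth $\mathrm{md}(M)$ of a $k$-model is the least $d<\omega$ with $\sim_{M,d}={\sim_{M,d+1}}$ (and $\omega$ if there is none). -}

module Defs where

open import Data.Nat using (ℕ; zero; suc; _≤_; _⊔_; _+_)
open import Data.Fin using (Fin)
open import Data.Product using (Σ; ∃; _×_; _,_; proj₁)
open import Data.Empty using (⊥)
open import Relation.Nullary using (¬_)
open import Relation.Binary.PropositionalEquality using (_≡_)
open import Function.Bundles using (_⇔_)

-- Modal formulas over the finite alphabet Al = Fin n of diamonds,
-- with propositional variables p_0 … p_{k-1} (i.e. k-formulas).
data Form (n k : ℕ) : Set where
  var  : Fin k → Form n k
  ⊥f   : Form n k
  ¬f_  : Form n k → Form n k
  _∧f_ : Form n k → Form n k → Form n k
  ◇f   : Fin n → Form n k → Form n k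

depth : ∀ {n k} → Form n k → ℕ
depth (var _)   = 0
depth ⊥f        = 0
depth (¬f φ)    = depth φ
depth (φ ∧f ψ)  = depth φ ⊔ depth ψ
depth (◇f _ φ)  = suc (depth φ)

record Model (n k : ℕ) : Set₁ where
  field
    X : Set
    R : Fin n → X → X → Set
    θ : Fin k → X → Set
open Model public

sat : ∀ {n k} (M : Model n k) → X M → Form n k → Set
sat M a (var p)   = θ M p a
sat M a ⊥f        = ⊥
sat M a (¬f φ)    = ¬ sat M a φ
sat M a (φ ∧f ψ)  = sat M a φ × sat M a ψ
sat M a (◇f i φ)  = Σ (X M) λ b → R M i a b × sat M b φ

RF : ∀ {n k} (M : Model n k) → X M → X M → Set
RF {n} M a b = Σ (Fin n) λ i → R M i a b

RFpow : ∀ {n k} (M : Model n k) → ℕ → X M → X M → Set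
RFpow M zero    a b = a ≡ b
RFpow M (suc j) a b = Σ (X M) λ c → RF M a c × RFpow M j c b

MTransitive : ∀ {n k} → Model n k → ℕ → Set
MTransitive M m = ∀ a b → RFpow M (suc m) a b → Σ ℕ λ i → i ≤ m × RFpow M i a b

Upset : ∀ {n k} (M : Model n k) → (X M → Set) → Set
Upset {n} M Y = ∀ (i : Fin n) a b → Y a → R M i a b → Y b

restrict : ∀ {n k} (M : Model n k) → (X M → Set) → Model n k
restrict M Y = record
  { X = Σ (X M) Y
  ; R = λ i a b → R M i (proj₁ a) (proj₁ b)
  ; θ = λ p a → θ M p (proj₁ a)
  }

SimD : ∀ {n k} (M : Model n k) → ℕ → X M → X M → Set
SimD M d a b = ∀ φ → depth φ ≤ d → (sat M a φ ⇔ sat M b φ)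

Sim : ∀ {n k} (M : Model n k) → X M → X M → Set
Sim M a b = ∀ φ → (sat M a φ ⇔ sat M b φ)

-- md(M) ≤ d : the least d' with ∼_{d'} = ∼_{d'+1} exists and is ≤ d,
-- equivalently some d' ≤ d has ∼_{d'} = ∼_{d'+1}.
MdLe : ∀ {n k} → Model n k → ℕ → Set
MdLe M d = Σ ℕ λ d' → d' ≤ d × (∀ a b → SimD M d' a b ⇔ SimD M (suc d') a b)

SimClosure : ∀ {n k} (M : Model n k) → (X M → Set) → X M → Set
SimClosure M Y x = Σ (X M) λ y → Y y × Sim M x y

{-# OPTIONS --safe #-}
module Submission where

-- Over the upset Y the modal depth is at most d, so there ∼_d already is ∼.  If y ∈ Y and
-- y ∼_{m+d+1} b, then every point c reachable from b in at most m steps has a ∼_{d+1}-partner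
-- in Y (copy the path from b to c step by step, starting at y), and by m-transitivity these
-- points form an upset.  The relation "y ∈ Y, c reachable from b, y ∼_{d+1} c" is then a
-- bisimulation: a step on either side only loses one degree, and the lost degree is recovered
-- by comparing with the partner in Y, where ∼_d and ∼ agree.  Hence y ∼ b, so ∼[Y] is
-- saturated under ∼_{m+d+1}, which gives all four claims.  Definability uses that Basis e is
-- a finite list of formulas of depth ≤ e on which agreement already forces ∼_e: the atoms
-- together with ◇ᵢ μ for the minterms μ over Basis (e - 1).

open import Defs
open import Level using (0ℓ)
open import Axiom.ExcludedMiddle using (ExcludedMiddle)
open import Data.Nat using (ℕ; zero; suc; _≤_; _+_; z≤n; s≤s)
open import Data.Nat.Properties
  using (≤-refl; ≤-trans; ≤-reflexive; n≤1+n; +-suc; +-comm; +-monoˡ-≤;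
         ⊔-lub; m⊔n≤o⇒m≤o; m⊔n≤o⇒n≤o; m≤n⇒m<n∨m≡n)
open import Data.List using (List; []; _∷_; _++_; map; allFin; filter; cartesianProductWith)
open import Data.List.Relation.Unary.Any using (here; there)
open import Data.List.Membership.Propositional using (_∈_)
open import Data.List.Membership.Propositional.Properties
  using (∈-++⁺ˡ; ∈-++⁺ʳ; ∈-++⁻; ∈-map⁺; ∈-map⁻; ∈-allFin; ∈-filter⁺; ∈-filter⁻;
         ∈-cartesianProductWith⁺; ∈-cartesianProductWith⁻)
open import Data.Product using (Σ; _×_; _,_; proj₁; proj₂)
open import Data.Product.Function.NonDependent.Propositional using (_×-⇔_)
open import Data.Sum using (inj₁; inj₂)
open import Data.Empty using (⊥-elim)
open import Function using (flip)
open import Function.Bundles using (_⇔_; mk⇔; Equivalence)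
open import Function.Related.TypeIsomorphisms using (¬-cong-⇔)
import Function.Properties.Equivalence as ⇔
open import Relation.Nullary using (Dec; yes; no)
open import Relation.Nullary.Decidable using (decidable-stable)
open import Relation.Binary.PropositionalEquality using (_≡_; refl; sym; trans)

open Equivalence using (to; from)

module _ {n k : ℕ} where

  ⊤f : Form n k
  ⊤f = ¬f ⊥f

  ⋁ : List (Form n k) → Form n k
  ⋁ []      = ⊥f
  ⋁ (φ ∷ L) = ¬f ((¬f φ) ∧f (¬f ⋁ L))

  minterms : List (Form n k) → List (Form n k)
  minterms []      = ⊤f ∷ []
  minterms (φ ∷ L) = cartesianProductWith _∧f_ (φ ∷ ¬f φ ∷ []) (minterms L)

  atoms : List (Form n k)
  atoms = map var (allFin k)

  Basis : ℕ → List (Form n k)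
  Basis zero    = atoms
  Basis (suc e) = atoms ++ cartesianProductWith ◇f (allFin n) (minterms (Basis e))

  ∈-minterms⁺ : ∀ {φ L ℓ χ} → ℓ ∈ φ ∷ ¬f φ ∷ [] → χ ∈ minterms L →
                ℓ ∧f χ ∈ minterms (φ ∷ L)
  ∈-minterms⁺ = ∈-cartesianProductWith⁺ _∧f_

  ∈-minterms⁻ : ∀ φ L {χ′} → χ′ ∈ minterms (φ ∷ L) →
                Σ (Form n k) λ ℓ → Σ (Form n k) λ χ →
                  ℓ ∈ φ ∷ ¬f φ ∷ [] × χ ∈ minterms L × χ′ ≡ ℓ ∧f χ
  ∈-minterms⁻ φ L = ∈-cartesianProductWith⁻ _∧f_ (φ ∷ ¬f φ ∷ []) (minterms L)

  ⋁-depth : ∀ {e} L → (∀ {φ} → φ ∈ L → depth φ ≤ e) → depth (⋁ L) ≤ e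
  ⋁-depth []      _ = z≤n
  ⋁-depth (φ ∷ L) h = ⊔-lub (h (here refl)) (⋁-depth L (λ φ∈ → h (there φ∈)))

  minterms-depth : ∀ {e} L → (∀ {φ} → φ ∈ L → depth φ ≤ e) →
                   ∀ {χ} → χ ∈ minterms L → depth χ ≤ e
  minterms-depth []      _ (here refl) = z≤n
  minterms-depth {e} (φ ∷ L) h χ∈
    with _ , χ , ℓ∈ , χ∈′ , refl ← ∈-minterms⁻ φ L χ∈
    = ⊔-lub (literal-depth ℓ∈) (minterms-depth L (λ φ∈ → h (there φ∈)) χ∈′)
    where
    literal-depth : ∀ {ℓ} → ℓ ∈ φ ∷ ¬f φ ∷ [] → depth ℓ ≤ e
    literal-depth (here refl)         = h (here refl)
    literal-depth (there (here refl)) = h (here refl)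

  atoms-depth : ∀ {e φ} → φ ∈ atoms → depth φ ≤ e
  atoms-depth φ∈ with _ , _ , refl ← ∈-map⁻ var φ∈ = z≤n

  Basis-depth : ∀ e {φ} → φ ∈ Basis e → depth φ ≤ e
  Basis-depth zero    φ∈ = atoms-depth φ∈
  Basis-depth (suc e) φ∈ with ∈-++⁻ atoms φ∈
  ... | inj₁ φ∈atoms = atoms-depth φ∈atoms
  ... | inj₂ φ∈◇
    with _ , _ , _ , χ∈ , refl ← ∈-cartesianProductWith⁻ ◇f (allFin n) _ φ∈◇
    = s≤s (minterms-depth _ (Basis-depth e) χ∈)

  var∈Basis : ∀ e p → var p ∈ Basis e
  var∈Basis zero    p = ∈-map⁺ var (∈-allFin p)
  var∈Basis (suc e) p = ∈-++⁺ˡ (∈-map⁺ var (∈-allFin p))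

  ◇∈Basis : ∀ e i {χ} → χ ∈ minterms (Basis e) → ◇f i χ ∈ Basis (suc e)
  ◇∈Basis e i χ∈ = ∈-++⁺ʳ atoms (∈-cartesianProductWith⁺ ◇f (∈-allFin i) χ∈)

module ModalEquivalence {n k : ℕ} (N : Model n k) where

  AtomsAgree : X N → X N → Set
  AtomsAgree a b = ∀ p → θ N p a ⇔ θ N p b

  AgreeOn : List (Form n k) → X N → X N → Set
  AgreeOn L a b = ∀ {φ} → φ ∈ L → sat N a φ ⇔ sat N b φ

  Forth : (X N → X N → Set) → X N → X N → Set
  Forth S a b = ∀ i {a′} → R N i a a′ → Σ (X N) λ b′ → R N i b b′ × S a′ b′

  Back : (X N → X N → Set) → X N → X N → Set
  Back S a b = Forth (flip S) b a

  IsBisimulation : (X N → X N → Set) → Set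
  IsBisimulation S = ∀ {a b} → S a b → AtomsAgree a b × Forth S a b × Back S a b

  Forth-map : ∀ {S S′ : X N → X N → Set} {a b} →
              (∀ {x y} → S x y → S′ x y) → Forth S a b → Forth S′ a b
  Forth-map f forth i r = let b′ , r′ , s = forth i r in b′ , r′ , f s

  SimD-sym : ∀ {e a b} → SimD N e a b → SimD N e b a
  SimD-sym s φ dφ = ⇔.sym (s φ dφ)

  SimD-trans : ∀ {e a b c} → SimD N e a b → SimD N e b c → SimD N e a c
  SimD-trans s t φ dφ = ⇔.trans (s φ dφ) (t φ dφ)

  SimD-mono : ∀ {e e′ a b} → e′ ≤ e → SimD N e a b → SimD N e′ a b
  SimD-mono e′≤e s φ dφ = s φ (≤-trans dφ e′≤e)

  Sim⇒SimD : ∀ {e a b} → Sim N a b → SimD N e a b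
  Sim⇒SimD s φ _ = s φ

  Sim-refl : ∀ {a} → Sim N a a
  Sim-refl φ = ⇔.refl

  Sim-sym : ∀ {a b} → Sim N a b → Sim N b a
  Sim-sym s φ = ⇔.sym (s φ)

  Sim-trans : ∀ {a b c} → Sim N a b → Sim N b c → Sim N a c
  Sim-trans s t φ = ⇔.trans (s φ) (t φ)

  SimD-intro : ∀ {e a b} → AtomsAgree a b →
               (∀ i φ → suc (depth φ) ≤ e → sat N a (◇f i φ) ⇔ sat N b (◇f i φ)) →
               SimD N e a b
  SimD-intro agree modal (var p)  _   = agree p
  SimD-intro agree modal ⊥f       _   = ⇔.refl
  SimD-intro agree modal (¬f φ)   dφ  = ¬-cong-⇔ (SimD-intro agree modal φ dφ)
  SimD-intro agree modal (φ ∧f ψ) dφψ =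
    SimD-intro agree modal φ (m⊔n≤o⇒m≤o (depth φ) (depth ψ) dφψ) ×-⇔
    SimD-intro agree modal ψ (m⊔n≤o⇒n≤o (depth φ) (depth ψ) dφψ)
  SimD-intro agree modal (◇f i φ) dφ  = modal i φ dφ

  SimD-zero : ∀ {a b} → AtomsAgree a b → SimD N 0 a b
  SimD-zero agree = SimD-intro agree λ _ _ ()

  SimD-suc : ∀ {e a b} → AtomsAgree a b → Forth (SimD N e) a b → Back (SimD N e) a b →
             SimD N (suc e) a b
  SimD-suc {e} {a} {b} agree forth back = SimD-intro agree modal
    where
    modal : ∀ i φ → suc (depth φ) ≤ suc e → sat N a (◇f i φ) ⇔ sat N b (◇f i φ)
    modal i φ (s≤s dφ) = mk⇔
      (λ (a′ , r , a′φ) → let b′ , r′ , s = forth i r  in b′ , r′ , to (s φ dφ) a′φ)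
      (λ (b′ , r′ , b′φ) → let a′ , r , s = back i r′ in a′ , r , from (s φ dφ) b′φ)

  bisimulation⇒SimD : ∀ {S} → IsBisimulation S → ∀ e {a b} → S a b → SimD N e a b
  bisimulation⇒SimD bisim zero    s = SimD-zero (proj₁ (bisim s))
  bisimulation⇒SimD bisim (suc e) s =
    let agree , forth , back = bisim s
    in SimD-suc agree (Forth-map (bisimulation⇒SimD bisim e) forth)
                      (Forth-map (bisimulation⇒SimD bisim e) back)

  bisimulation⇒Sim : ∀ {S} → IsBisimulation S → ∀ {a b} → S a b → Sim N a b
  bisimulation⇒Sim bisim s φ = bisimulation⇒SimD bisim (depth φ) s φ ≤-refl

  SimD⊆Sim⇒MdLe : ∀ {e} → (∀ {a b} → SimD N e a b → Sim N a b) → MdLe N e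
  SimD⊆Sim⇒MdLe {e} collapse =
    e , ≤-refl , λ _ _ → mk⇔ (λ s → Sim⇒SimD (collapse s)) (SimD-mono (n≤1+n e))

  minterm-agree : ∀ L {χ a b} → χ ∈ minterms L → sat N a χ → sat N b χ → AgreeOn L a b
  minterm-agree (φ ∷ L) χ∈ aχ bχ (there φ′∈)
    with _ , _ , _ , χ∈′ , refl ← ∈-minterms⁻ φ L χ∈
    = minterm-agree L χ∈′ (proj₂ aχ) (proj₂ bχ) φ′∈
  minterm-agree (φ ∷ L) χ∈ aχ bχ (here refl) with ∈-minterms⁻ φ L χ∈
  ... | _ , _ , here refl , _ , refl =
    mk⇔ (λ _ → proj₁ bχ) (λ _ → proj₁ aχ)
  ... | _ , _ , there (here refl) , _ , refl =
    mk⇔ (λ aφ → ⊥-elim (proj₁ aχ aφ)) (λ bφ → ⊥-elim (proj₁ bχ bφ))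

  ⋁-intro : ∀ {x χ} L → χ ∈ L → sat N x χ → sat N x (⋁ L)
  ⋁-intro (χ ∷ L) (here refl) xχ (¬xχ , _)  = ¬xχ xχ
  ⋁-intro (χ ∷ L) (there χ∈)  xχ (_ , ¬x⋁) = ¬x⋁ (⋁-intro L χ∈ xχ)

module Characteristic (lem : ExcludedMiddle 0ℓ) {n k : ℕ} (N : Model n k) where
  open ModalEquivalence N

  minterm-sat : ∀ c L → Σ (Form n k) λ χ → χ ∈ minterms L × sat N c χ
  minterm-sat c []      = ⊤f , here refl , λ ()
  minterm-sat c (φ ∷ L) with minterm-sat c L | lem {sat N c φ}
  ... | χ , χ∈ , cχ | yes cφ  = φ ∧f χ , ∈-minterms⁺ {L = L} (here refl) χ∈ , cφ , cχ
  ... | χ , χ∈ , cχ | no ¬cφ =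
    (¬f φ) ∧f χ , ∈-minterms⁺ {L = L} (there (here refl)) χ∈ , ¬cφ , cχ

  ⋁-elim : ∀ {x} L → sat N x (⋁ L) → Σ (Form n k) λ χ → χ ∈ L × sat N x χ
  ⋁-elim {x} (χ ∷ L) x⋁ with lem {sat N x χ}
  ... | yes xχ  = χ , here refl , xχ
  ... | no ¬xχ =
    let χ′ , χ′∈ , xχ′ = ⋁-elim L (decidable-stable lem λ ¬x⋁ → x⋁ (¬xχ , ¬x⋁))
    in χ′ , there χ′∈ , xχ′

  ◇minterms⇒Forth : ∀ L {a b} →
                    (∀ i {χ} → χ ∈ minterms L → sat N a (◇f i χ) → sat N b (◇f i χ)) →
                    Forth (AgreeOn L) a b
  ◇minterms⇒Forth L ◇χ i {a′} r =
    let χ , χ∈ , a′χ = minterm-sat a′ L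
        b′ , r′ , b′χ = ◇χ i χ∈ (a′ , r , a′χ)
    in b′ , r′ , minterm-agree L χ∈ a′χ b′χ

  AgreeOn-Basis⇒SimD : ∀ e {a b} → AgreeOn (Basis e) a b → SimD N e a b
  AgreeOn-Basis⇒SimD zero    agree = SimD-zero (λ p → agree (var∈Basis 0 p))
  AgreeOn-Basis⇒SimD (suc e) agree = SimD-suc (λ p → agree (var∈Basis (suc e) p))
    (Forth-map (AgreeOn-Basis⇒SimD e)
      (◇minterms⇒Forth (Basis e) λ i χ∈ → to (agree (◇∈Basis e i χ∈))))
    (Forth-map {S = AgreeOn (Basis e)} (λ agree′ → SimD-sym (AgreeOn-Basis⇒SimD e agree′))
      (◇minterms⇒Forth (Basis e) λ i χ∈ → from (agree (◇∈Basis e i χ∈))))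

  SimD-forth : ∀ {e a b} → SimD N (suc e) a b → Forth (SimD N e) a b
  SimD-forth {e} s = Forth-map (AgreeOn-Basis⇒SimD e) (◇minterms⇒Forth (Basis e)
    λ i {χ} χ∈ → to (s (◇f i χ) (s≤s (minterms-depth (Basis e) (Basis-depth e) χ∈))))

  SimD-back : ∀ {e a b} → SimD N (suc e) a b → Back (SimD N e) a b
  SimD-back s = Forth-map SimD-sym (SimD-forth (SimD-sym s))

  SimD-forth-RFpow : ∀ j {e a b a′} → SimD N (j + e) a b → RFpow N j a a′ →
                     Σ (X N) λ b′ → RFpow N j b b′ × SimD N e a′ b′
  SimD-forth-RFpow zero    {b = b} s refl = b , refl , s
  SimD-forth-RFpow (suc j) s (a₁ , (i , r) , path) =
    let b₁ , r′ , s₁     = SimD-forth s i r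
        b′ , path′ , s′ = SimD-forth-RFpow j s₁ path
    in b′ , (b₁ , (i , r′) , path′) , s′

  SimD-stable⇒Sim : ∀ {e} → (∀ {a b} → SimD N e a b → SimD N (suc e) a b) →
                    ∀ {a b} → SimD N e a b → Sim N a b
  SimD-stable⇒Sim stable = bisimulation⇒Sim λ s →
    (λ p → s (var p) z≤n) , SimD-forth (stable s) , SimD-back (stable s)

  MdLe⇒SimD⊆Sim : ∀ {d} → MdLe N d → ∀ {a b} → SimD N d a b → Sim N a b
  MdLe⇒SimD⊆Sim (_ , d′≤d , stable) s =
    SimD-stable⇒Sim (λ {a} {b} → to (stable a b)) (SimD-mono d′≤d s)

  SimD-closed⇒definable : ∀ {e} (Z : X N → Set) → (∀ {a b} → Z a → SimD N e a b → Z b) →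
                          Σ (Form n k) λ φ → depth φ ≤ e × (∀ x → sat N x φ ⇔ Z x)
  SimD-closed⇒definable {e} Z closed =
    ⋁ realised , ⋁-depth realised realised-depth , λ x → mk⇔ (⋁⇒Z x) (Z⇒⋁ x)
    where
    Realised : Form n k → Set
    Realised χ = Σ (X N) λ z → Z z × sat N z χ

    realised? : ∀ χ → Dec (Realised χ)
    realised? χ = lem

    realised : List (Form n k)
    realised = filter realised? (minterms (Basis e))

    realised-depth : ∀ {χ} → χ ∈ realised → depth χ ≤ e
    realised-depth χ∈ = minterms-depth (Basis e) (Basis-depth e) (proj₁ (∈-filter⁻ realised? χ∈))

    ⋁⇒Z : ∀ x → sat N x (⋁ realised) → Z x
    ⋁⇒Z x x⋁ =
      let χ , χ∈ , xχ = ⋁-elim realised x⋁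
          χ∈minterms , z , z∈Z , zχ = ∈-filter⁻ realised? χ∈
      in closed z∈Z (AgreeOn-Basis⇒SimD e (minterm-agree (Basis e) χ∈minterms zχ xχ))

    Z⇒⋁ : ∀ x → Z x → sat N x (⋁ realised)
    Z⇒⋁ x x∈Z =
      let χ , χ∈ , xχ = minterm-sat x (Basis e)
      in ⋁-intro realised (∈-filter⁺ realised? χ∈ (x , x∈Z , xχ)) xχ

module Restriction {n k : ℕ} (M : Model n k) {Z : X M → Set} (up : Upset M Z) where

  sat-restrict : ∀ φ p → sat (restrict M Z) p φ ⇔ sat M (proj₁ p) φ
  sat-restrict (var _)  _ = ⇔.refl
  sat-restrict ⊥f       _ = ⇔.refl
  sat-restrict (¬f φ)   p = ¬-cong-⇔ (sat-restrict φ p)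
  sat-restrict (φ ∧f ψ) p = sat-restrict φ p ×-⇔ sat-restrict ψ p
  sat-restrict (◇f i φ) (a , a∈Z) = mk⇔
    (λ ((a′ , a′∈Z) , r , a′φ) → a′ , r , to (sat-restrict φ (a′ , a′∈Z)) a′φ)
    (λ (a′ , r , a′φ) → let a′∈Z = up i a a′ a∈Z r
                         in (a′ , a′∈Z) , r , from (sat-restrict φ (a′ , a′∈Z)) a′φ)

  sat-restrict-cong : ∀ φ p q → (sat (restrict M Z) p φ ⇔ sat (restrict M Z) q φ) ⇔
                                (sat M (proj₁ p) φ ⇔ sat M (proj₁ q) φ)
  sat-restrict-cong φ p q = mk⇔
    (λ pq → ⇔.trans (⇔.sym (sat-restrict φ p)) (⇔.trans pq (sat-restrict φ q)))
    (λ pq → ⇔.trans (sat-restrict φ p) (⇔.trans pq (⇔.sym (sat-restrict φ q))))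

  SimD-restrict : ∀ {e p q} → SimD (restrict M Z) e p q ⇔ SimD M e (proj₁ p) (proj₁ q)
  SimD-restrict {p = p} {q} = mk⇔ (λ s φ dφ → to   (sat-restrict-cong φ p q) (s φ dφ))
                                  (λ s φ dφ → from (sat-restrict-cong φ p q) (s φ dφ))

  Sim-restrict : ∀ {p q} → Sim (restrict M Z) p q ⇔ Sim M (proj₁ p) (proj₁ q)
  Sim-restrict {p} {q} = mk⇔ (λ s φ → to   (sat-restrict-cong φ p q) (s φ))
                             (λ s φ → from (sat-restrict-cong φ p q) (s φ))

module Paths {n k : ℕ} (M : Model n k) where

  RFpow-snoc : ∀ j {a b c} → RFpow M j a b → RF M b c → RFpow M (suc j) a c
  RFpow-snoc zero    {c = c} refl r          = c , r , refl
  RFpow-snoc (suc j)         (a₁ , r₁ , path) r = a₁ , r₁ , RFpow-snoc j path r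

  Upset-RFpow : ∀ {Y} → Upset M Y → ∀ j {a b} → Y a → RFpow M j a b → Y b
  Upset-RFpow up zero    a∈Y refl                 = a∈Y
  Upset-RFpow up (suc j) a∈Y (a₁ , (i , r) , path) = Upset-RFpow up j (up i _ a₁ a∈Y r) path

  Reach≤ : ℕ → X M → X M → Set
  Reach≤ m a c = Σ ℕ λ j → j ≤ m × RFpow M j a c

  Reach≤-upset : ∀ {m} → MTransitive M m → ∀ a → Upset M (Reach≤ m a)
  Reach≤-upset {m} mt a i c c′ (j , j≤m , path) r with m≤n⇒m<n∨m≡n j≤m
  ... | inj₁ j<m  = suc j , j<m , RFpow-snoc j path (i , r)
  ... | inj₂ refl = mt a c′ (RFpow-snoc j path (i , r))

module Saturation (lem : ExcludedMiddle 0ℓ) {n k m d : ℕ} (M : Model n k) (mt : MTransitive M m)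
                  {Y : X M → Set} (up : Upset M Y) (md : MdLe (restrict M Y) d) where
  open ModalEquivalence M
  open Characteristic lem M
  open Paths M

  D : ℕ
  D = m + d + 1

  j+suc-d≤D : ∀ {j} → j ≤ m → j + suc d ≤ D
  j+suc-d≤D j≤m = ≤-trans (+-monoˡ-≤ (suc d) j≤m)
                          (≤-reflexive (trans (+-suc m d) (sym (+-comm (m + d) 1))))

  SimD-on-Y⇒Sim : ∀ {y y′} → Y y → Y y′ → SimD M d y y′ → Sim M y y′
  SimD-on-Y⇒Sim y∈Y y′∈Y s =
    to Sim-restrict (Characteristic.MdLe⇒SimD⊆Sim lem (restrict M Y) md
                      (from (SimD-restrict {p = _ , y∈Y} {_ , y′∈Y}) s))
    where open Restriction M up

  SimD-from-Y⇒Sim : ∀ {y₀ b} → Y y₀ → SimD M D y₀ b → Sim M y₀ b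
  SimD-from-Y⇒Sim {y₀} {b} y₀∈Y s₀ =
    bisimulation⇒Sim isBisimulation (y₀∈Y , (0 , z≤n , refl) , SimD-mono (j+suc-d≤D z≤n) s₀)
    where
    T : X M → Set
    T = Reach≤ m b

    partner : ∀ {c} → T c → Σ (X M) λ y → Y y × SimD M (suc d) y c
    partner (j , j≤m , path) =
      let y , path′ , s = SimD-forth-RFpow j (SimD-mono (j+suc-d≤D j≤m) (SimD-sym s₀)) path
      in y , Upset-RFpow up j y₀∈Y path′ , SimD-sym s

    upgrade : ∀ {y c} → Y y → T c → SimD M d y c → SimD M (suc d) y c
    upgrade y∈Y c∈T s =
      let y′ , y′∈Y , s′ = partner c∈T
          y∼y′ = SimD-on-Y⇒Sim y∈Y y′∈Y (SimD-trans s (SimD-sym (SimD-mono (n≤1+n d) s′)))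
      in SimD-trans (Sim⇒SimD y∼y′) s′

    S : X M → X M → Set
    S y c = Y y × T c × SimD M (suc d) y c

    isBisimulation : IsBisimulation S
    isBisimulation {y} {c} (y∈Y , c∈T , s) = (λ p → s (var p) z≤n) , forth , back
      where
      step : ∀ {i y′ c′} → R M i y y′ → R M i c c′ → SimD M d y′ c′ → S y′ c′
      step {i} {y′} {c′} r r′ s′ =
        let y′∈Y = up i y y′ y∈Y r
            c′∈T = Reach≤-upset mt b i c c′ c∈T r′
        in y′∈Y , c′∈T , upgrade y′∈Y c′∈T s′

      forth : Forth S y c
      forth i r = let c′ , r′ , s′ = SimD-forth s i r in c′ , r′ , step r r′ s′

      back : Back S y c
      back i r′ = let y′ , r , s′ = SimD-back s i r′ in y′ , r , step r r′ s′

  Z : X M → Set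
  Z = SimClosure M Y

  Z-SimD-saturated : ∀ a b → Z a → SimD M D a b → Z b × Sim M a b
  Z-SimD-saturated a b (y , y∈Y , a∼y) s =
    let y∼b = SimD-from-Y⇒Sim y∈Y (SimD-trans (SimD-sym (Sim⇒SimD a∼y)) s)
    in (y , y∈Y , Sim-sym y∼b) , Sim-trans a∼y y∼b

  Z-upset : Upset M Z
  Z-upset i a a′ (y , y∈Y , a∼y) r =
    let y′ , r′ , s = SimD-forth (Sim⇒SimD {e = suc D} a∼y) i r
    in proj₁ (Z-SimD-saturated y′ a′ (y′ , up i y y′ y∈Y r′ , Sim-refl) (SimD-sym s))

  Z-definable : Σ (Form n k) λ φ → depth φ ≤ D × (∀ x → sat M x φ ⇔ Z x)
  Z-definable = SimD-closed⇒definable Z λ {a} {b} a∈Z s → proj₁ (Z-SimD-saturated a b a∈Z s)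

  Z-MdLe : MdLe (restrict M Z) D
  Z-MdLe = ModalEquivalence.SimD⊆Sim⇒MdLe (restrict M Z) λ {p} {q} s →
    from Sim-restrict (proj₂ (Z-SimD-saturated _ _ (proj₂ p) (to SimD-restrict s)))
    where open Restriction M Z-upset

proposition6p17 : ExcludedMiddle 0ℓ →
    ∀ {n k m d : ℕ} (M : Model n k) → MTransitive M m →
    (Y : X M → Set) → Upset M Y → MdLe (restrict M Y) d →
      (∀ a b → SimClosure M Y a → SimD M (m + d + 1) a b →
         SimClosure M Y b × Sim M a b)
      × Upset M (SimClosure M Y)
      × (Σ (Form n k) λ φ → depth φ ≤ m + d + 1 ×
           (∀ x → sat M x φ ⇔ SimClosure M Y x))
      × MdLe (restrict M (SimClosure M Y)) (m + d + 1)
proposition6p17 lem M mt Y up md = Z-SimD-saturated , Z-upset , Z-definable , Z-MdLe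
  where open Saturation lem M mt up md
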